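{- Let $p$ be an odd prime with $p \equiv 2 \pmod 3$, and let $c$ be an integer with $1 \le c \le p-1$. Let $M_p = [m_{ij}]_{1 \le i,j \le p}$ be the $p \times p$ matrix with entries $m_{ij} = \left[ \frac{j-i+c}{p} \right]$. Then $\det(M_p) = p-1$.
   Context: For an odd prime $p$ and an integer $a$, the cubic residue symbol is defined by $\left[ \frac{a}{p} \right] = 1$ if $a \not\equiv 0 \pmod p$ and $x^3 \equiv a \pmod p$ has an integer solution; $\left[ \frac{a}{p} \right] = -1$ if $x^3 \equiv a \pmod p$ has no integer solution; and $\left[ \frac{a}{p} \right] = 0$ if $a \equiv 0 \pmod p$. -}

module Defs where

open import Data.Nat as ℕ using (ℕ; zero; suc)
open import Data.Integer using (ℤ; +_; -_; _+_; _*_; _-_; 0ℤ; 1ℤ; -1ℤ)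
open import Data.Integer.DivMod using (_%ℕ_)
open import Data.Fin using (Fin; zero; suc; toℕ; punchIn)
open import Data.Fin.Properties using (any?)
open import Data.Product using (∃)
open import Relation.Binary.PropositionalEquality using (_≡_)
open import Relation.Nullary using (Dec; yes; no)

-- Decidable: does x³ ≡ a (mod p) have a solution?  It suffices (and is
-- equivalent) to search residues x ∈ {0,…,p-1}.  Defined for p = suc q.
cubeSolvable? : (q : ℕ) (a : ℤ) →
  Dec (∃ λ (x : Fin (suc q)) → (+ (toℕ x ℕ.^ 3)) %ℕ suc q ≡ a %ℕ suc q)
cubeSolvable? q a = any? (λ x → (+ (toℕ x ℕ.^ 3)) %ℕ suc q ℕ.≟ a %ℕ suc q)

-- Cubic residue symbol [a/p] as in the paper (value for p = 0 is irrelevant).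
cubicSym : ℤ → ℕ → ℤ
cubicSym a zero = 0ℤ
cubicSym a (suc q) with a %ℕ suc q ℕ.≟ 0
... | yes _ = 0ℤ
... | no _ with cubeSolvable? q a
...   | yes _ = 1ℤ
...   | no _ = -1ℤ

sgn : ℕ → ℤ
sgn zero = 1ℤ
sgn (suc k) = - sgn k

∑ : (n : ℕ) → (Fin n → ℤ) → ℤ
∑ zero f = 0ℤ
∑ (suc n) f = f zero + ∑ n (λ i → f (suc i))

det : (n : ℕ) → (Fin n → Fin n → ℤ) → ℤ
det zero M = 1ℤ
det (suc n) M =
  ∑ (suc n) (λ j → sgn (toℕ j) * M zero j * det n (λ i k → M (suc i) (punchIn j k)))

-- The matrix M_p with entries [ (j - i + c) / p ]  (indices shifted to 0-based;
-- only j - i matters).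
Mp : (p c : ℕ) → Fin p → Fin p → ℤ
Mp p c i j = cubicSym ((+ toℕ j) - (+ toℕ i) + (+ c)) p

module Submission where

-- Write p = 3m + 2.  By Fermat's little theorem x = r^(2m+1) is a cube root
-- of r modulo p, since 3(2m + 1) = p + (p − 1).  Hence [a/p] is 0 when p ∣ a and 1
-- otherwise, and M_p is the 0/1 circulant C_c with entries [j − i + c ≢ 0 (mod p)].
-- Moving the last row of C_t to the top yields C_(t+1); this cyclic permutation of
-- the p rows has sign (−1)^(p−1) = 1, so det C_c = det C_0 = det (J − I), and a
-- cofactor recursion gives det (J − I) = (−1)^(n−1) (n − 1) in size n.

open import Defs
open import Data.Nat using (ℕ; zero; suc; _≤_; _%_; _∸_)
open import Data.Nat.Primality using (Prime)
open import Data.Integer using (+_)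
open import Relation.Binary.PropositionalEquality using (_≡_)

module FermatsLittleTheorem where

  open import Data.Nat
  open import Data.Nat.Properties
  open import Data.Nat.Combinatorics using (_C_; nC1≡n; nCn≡1; nCk+nC[k+1]≡[n+1]C[k+1])
  open import Data.Nat.Combinatorics.Specification using (k>n⇒nCk≡0)
  open import Data.Nat.Divisibility using (_∣_; m∣m*n; ∣m⇒∣m*n; ∣m∣n⇒∣m+n; >⇒∤; _∣0)
  open import Data.Nat.DivMod using (%-remove-+ʳ; %-distribˡ-+)
  open import Data.Nat.Primality using (euclidsLemma)
  open import Data.Nat.Tactic.RingSolver using (solve-∀)
  open import Data.Fin using (Fin; zero; suc; toℕ; inject₁; fromℕ)
  open import Data.Fin.Properties using (toℕ-inject₁; toℕ-fromℕ; toℕ<n)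
  open import Data.Vec.Functional using (Vector)
  open import Data.Sum using (inj₁; inj₂)
  open import Relation.Nullary using (contradiction)
  open import Algebra.Properties.Monoid.Sum +-0-monoid using (sum; sum-cong-≗; sum-init-last)
  open import Algebra.Definitions.RawMonoid +-0-rawMonoid using (_×_)
  import Algebra.Properties.CommutativeSemiring.Binomial +-*-commutativeSemiring as Binomial
  import Algebra.Properties.Semiring.Exp +-*-semiring as Exp
  open import Relation.Binary.PropositionalEquality
  open ≡-Reasoning

  absorption : ∀ n k → suc k * (suc n C suc k) ≡ suc n * (n C k)
  absorption n zero = trans (*-identityˡ _) (trans (nC1≡n (suc n)) (sym (*-identityʳ (suc n))))
  absorption zero (suc k) = begin
    suc (suc k) * (1 C suc (suc k)) ≡⟨ cong (suc (suc k) *_) (k>n⇒nCk≡0 {1} {suc (suc k)} (s≤s (s≤s z≤n))) ⟩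
    suc (suc k) * 0                 ≡⟨ *-zeroʳ (suc (suc k)) ⟩
    0                               ≡⟨ cong (1 *_) (k>n⇒nCk≡0 {0} {suc k} (s≤s z≤n)) ⟨
    1 * (0 C suc k)                 ∎
  absorption (suc n) (suc k) = begin
    (2 + k) * ((2 + n) C (2 + k))
      ≡⟨ cong ((2 + k) *_) (nCk+nC[k+1]≡[n+1]C[k+1] (suc n) (suc k)) ⟨
    (2 + k) * (c₁ + c₂)
      ≡⟨ expand (suc k) c₁ c₂ ⟩
    c₁ + suc k * c₁ + (2 + k) * c₂
      ≡⟨ cong₂ (λ x y → c₁ + x + y) (absorption n k) (absorption n (suc k)) ⟩
    c₁ + suc n * (n C k) + suc n * (n C suc k)
      ≡⟨ collect c₁ (suc n) (n C k) (n C suc k) ⟩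
    c₁ + suc n * (n C k + n C suc k)
      ≡⟨ cong (λ x → c₁ + suc n * x) (nCk+nC[k+1]≡[n+1]C[k+1] n k) ⟩
    (2 + n) * c₁ ∎
    where
    c₁ = suc n C suc k
    c₂ = suc n C (2 + k)
    expand : ∀ k x y → (1 + k) * (x + y) ≡ x + k * x + (1 + k) * y
    expand = solve-∀
    collect : ∀ c m a b → c + m * a + m * b ≡ c + m * (a + b)
    collect = solve-∀

  -- A prime p divides every inner binomial coefficient C(p,k), 0 < k < p:
  -- it divides k·C(p,k) = p·C(p-1,k-1) but not k.
  prime∣binomial : ∀ {p k} → Prime p → 0 < k → k < p → p ∣ p C k
  prime∣binomial {suc n} {suc k} p-prime _ k<p
    with euclidsLemma (suc k) (suc n C suc k) p-prime
           (subst (suc n ∣_) (sym (absorption n k)) (m∣m*n (n C k)))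
  ... | inj₁ p∣k+1 = contradiction p∣k+1 (>⇒∤ k<p)
  ... | inj₂ p∣C   = p∣C

  -- The library's binomial theorem, restated with ℕ's own _^_ and _*_ in place of
  -- the generic power and multiple of a semiring.
  binomialTheorem : ∀ n x y →
    (x + y) ^ n ≡ sum (λ (k : Fin (suc n)) → (n C toℕ k) * (x ^ toℕ k * y ^ (n ∸ toℕ k)))
  binomialTheorem n x y = begin
    (x + y) ^ n                       ≡⟨ ^≡Exp^ (x + y) n ⟩
    (x + y) Exp.^ n                   ≡⟨ Binomial.theorem n x y ⟩
    Binomial.binomialExpansion x y n  ≡⟨ sum-cong-≗ term ⟩
    sum {suc n} (λ k → (n C toℕ k) * (x ^ toℕ k * y ^ (n ∸ toℕ k))) ∎
    where
    ^≡Exp^ : ∀ x n → x ^ n ≡ x Exp.^ n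
    ^≡Exp^ x zero    = refl
    ^≡Exp^ x (suc n) = cong (x *_) (^≡Exp^ x n)
    ×≡* : ∀ m x → m × x ≡ m * x
    ×≡* zero    x = refl
    ×≡* (suc m) x = cong (_+_ x) (×≡* m x)
    term : ∀ k → Binomial.binomialTerm x y n k ≡ (n C toℕ k) * (x ^ toℕ k * y ^ (n ∸ toℕ k))
    term k = trans (×≡* (n C toℕ k) _)
      (cong ((n C toℕ k) *_) (sym (cong₂ _*_ (^≡Exp^ x (toℕ k)) (^≡Exp^ y (n ∸ toℕ k)))))

  ∣-sum : ∀ {d n} (f : Vector ℕ n) → (∀ i → d ∣ f i) → d ∣ sum f
  ∣-sum {n = zero}  f d∣f = _ ∣0
  ∣-sum {n = suc n} f d∣f = ∣m∣n⇒∣m+n (d∣f zero) (∣-sum (λ i → f (suc i)) (λ i → d∣f (suc i)))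

  sum≡ends-mod : ∀ {d n} .{{_ : NonZero d}} (f : Vector ℕ (2 + n)) →
    (∀ i → d ∣ f (suc (inject₁ i))) → sum f % d ≡ (f zero + f (fromℕ (suc n))) % d
  sum≡ends-mod {d} {n} f d∣inner = begin
    (f zero + sum (λ i → f (suc i))) % d   ≡⟨ cong (λ s → (f zero + s) % d) (sum-init-last (λ i → f (suc i))) ⟩
    (f zero + (inner + f last)) % d        ≡⟨ cong (_% d) (reorder (f zero) inner (f last)) ⟩
    (f zero + f last + inner) % d          ≡⟨ %-remove-+ʳ (f zero + f last) (∣-sum _ d∣inner) ⟩
    (f zero + f last) % d                  ∎
    where
    last = fromℕ (suc n)
    inner = sum (λ i → f (suc (inject₁ i)))
    reorder : ∀ a b c → a + (b + c) ≡ a + c + b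
    reorder = solve-∀

  module _ {q : ℕ} (p-prime : Prime (suc q)) where

    private
      p = suc q

    freshmansDream : ∀ a → (a + 1) ^ p % p ≡ (a ^ p + 1) % p
    freshmansDream a = begin
      (a + 1) ^ p % p                 ≡⟨ cong (_% p) (binomialTheorem p a 1) ⟩
      sum term % p                    ≡⟨ sum≡ends-mod term inner ⟩
      (term zero + term (fromℕ p)) % p ≡⟨ cong₂ (λ x y → (x + y) % p) first last ⟩
      (1 + a ^ p) % p                 ≡⟨ cong (_% p) (+-comm 1 (a ^ p)) ⟩
      (a ^ p + 1) % p                 ∎
      where
      term : Fin (suc p) → ℕ
      term k = (p C toℕ k) * (a ^ toℕ k * 1 ^ (p ∸ toℕ k))
      inner : ∀ i → p ∣ term (suc (inject₁ i))
      inner i = ∣m⇒∣m*n _ (prime∣binomial p-prime z<s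
        (subst (_< p) (sym (cong suc (toℕ-inject₁ i))) (s≤s (toℕ<n i))))
      first : term zero ≡ 1
      first = trans (+-identityʳ _) (trans (*-identityˡ _) (^-zeroˡ p))
      last : term (fromℕ p) ≡ a ^ p
      last = begin
        (p C toℕ (fromℕ p)) * (a ^ toℕ (fromℕ p) * 1 ^ (p ∸ toℕ (fromℕ p)))
          ≡⟨ cong (λ k → (p C k) * (a ^ k * 1 ^ (p ∸ k))) (toℕ-fromℕ p) ⟩
        (p C p) * (a ^ p * 1 ^ (p ∸ p))
          ≡⟨ cong₂ (λ c e → c * (a ^ p * 1 ^ e)) (nCn≡1 p) (n∸n≡0 p) ⟩
        1 * (a ^ p * 1)
          ≡⟨ trans (*-identityˡ _) (*-identityʳ _) ⟩
        a ^ p ∎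

    fermat : ∀ a → a ^ p % p ≡ a % p
    fermat zero    = refl
    fermat (suc a) = begin
      suc a ^ p % p               ≡⟨ cong (λ x → x ^ p % p) (+-comm 1 a) ⟩
      (a + 1) ^ p % p             ≡⟨ freshmansDream a ⟩
      (a ^ p + 1) % p             ≡⟨ %-distribˡ-+ (a ^ p) 1 p ⟩
      (a ^ p % p + 1 % p) % p     ≡⟨ cong (λ x → (x + 1 % p) % p) (fermat a) ⟩
      (a % p + 1 % p) % p         ≡⟨ %-distribˡ-+ a 1 p ⟨
      (a + 1) % p                 ≡⟨ cong (_% p) (+-comm a 1) ⟩
      suc a % p                   ∎

module CubesModuloP where

  open FermatsLittleTheorem using (fermat)
  open import Data.Nat
  open import Data.Nat.Properties
  open import Data.Nat.DivMod using (_/_; m≡m%n+[m/n]*n; m%n<n; m%n%n≡m%n; %-distribˡ-*; m<n⇒m%n≡m)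
  open import Data.Nat.Tactic.RingSolver using (solve-∀)
  open import Data.Fin using (Fin; toℕ; fromℕ<)
  open import Data.Fin.Properties using (toℕ-fromℕ<)
  open import Data.Product using (∃; _,_)
  open import Relation.Binary.PropositionalEquality
  open ≡-Reasoning

  %-absorbˡ-* : ∀ a b d .{{_ : NonZero d}} → ((a % d) * b) % d ≡ (a * b) % d
  %-absorbˡ-* a b d = begin
    ((a % d) * b) % d               ≡⟨ %-distribˡ-* (a % d) b d ⟩
    ((a % d % d) * (b % d)) % d     ≡⟨ cong (λ x → (x * (b % d)) % d) (m%n%n≡m%n a d) ⟩
    ((a % d) * (b % d)) % d         ≡⟨ %-distribˡ-* a b d ⟨
    (a * b) % d                     ∎

  %-absorb-^ : ∀ a k d .{{_ : NonZero d}} → (a % d) ^ k % d ≡ a ^ k % d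
  %-absorb-^ a zero    d = refl
  %-absorb-^ a (suc k) d = begin
    ((a % d) * (a % d) ^ k) % d     ≡⟨ %-distribˡ-* (a % d) ((a % d) ^ k) d ⟩
    ((a % d % d) * ((a % d) ^ k % d)) % d ≡⟨ cong₂ (λ x y → (x * y) % d) (m%n%n≡m%n a d) (%-absorb-^ a k d) ⟩
    ((a % d) * (a ^ k % d)) % d     ≡⟨ %-distribˡ-* a (a ^ k) d ⟨
    (a * a ^ k) % d                 ∎

  -- For a prime p = 3m + 2 every residue is a cube: with e = 2m + 1 we have
  -- 3e = p + (p - 1), so (r^e)³ = r^p · r^(p-1) ≡ r · r^(p-1) = r^p ≡ r by Fermat.
  cubeRoot : ∀ {q} → Prime (suc q) → suc q % 3 ≡ 2 →
    ∀ r → r < suc q → ∃ λ (x : Fin (suc q)) → toℕ x ^ 3 % suc q ≡ r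
  cubeRoot {q} p-prime p≡2 r r<p = fromℕ< (m%n<n (r ^ e) p) , cube≡r
    where
    p = suc q
    m = p / 3
    q≡3m+1 : q ≡ suc (m * 3)
    q≡3m+1 = suc-injective (trans (m≡m%n+[m/n]*n p 3) (cong (_+ m * 3) p≡2))
    e = 2 * m + 1
    3e≡p+q : e * 3 ≡ p + q
    3e≡p+q = trans (arith m) (cong (λ x → suc x + x) (sym q≡3m+1))
      where arith : ∀ m → (2 * m + 1) * 3 ≡ suc (suc (m * 3)) + suc (m * 3)
            arith = solve-∀
    cube≡r : toℕ (fromℕ< (m%n<n (r ^ e) p)) ^ 3 % p ≡ r
    cube≡r = begin
      toℕ (fromℕ< (m%n<n (r ^ e) p)) ^ 3 % p ≡⟨ cong (λ x → x ^ 3 % p) (toℕ-fromℕ< (m%n<n (r ^ e) p)) ⟩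
      (r ^ e % p) ^ 3 % p           ≡⟨ %-absorb-^ (r ^ e) 3 p ⟩
      (r ^ e) ^ 3 % p               ≡⟨ cong (_% p) (^-*-assoc r e 3) ⟩
      r ^ (e * 3) % p               ≡⟨ cong (λ x → r ^ x % p) 3e≡p+q ⟩
      r ^ (p + q) % p               ≡⟨ cong (_% p) (^-distribˡ-+-* r p q) ⟩
      (r ^ p * r ^ q) % p           ≡⟨ %-absorbˡ-* (r ^ p) (r ^ q) p ⟨
      ((r ^ p % p) * r ^ q) % p     ≡⟨ cong (λ x → (x * r ^ q) % p) (fermat p-prime r) ⟩
      ((r % p) * r ^ q) % p         ≡⟨ %-absorbˡ-* r (r ^ q) p ⟩
      r ^ p % p                     ≡⟨ fermat p-prime r ⟩
      r % p                         ≡⟨ m<n⇒m%n≡m r<p ⟩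
      r                             ∎

module CubicResidueSymbol where

  open CubesModuloP using (cubeRoot)
  open import Data.Nat as ℕ using (ℕ; zero; suc; _%_)
  open import Data.Integer using (ℤ; 0ℤ; 1ℤ)
  open import Data.Integer.DivMod using (_%ℕ_; n%ℕd<d)
  open import Relation.Nullary using (¬_; yes; no; contradiction)
  open import Relation.Binary.PropositionalEquality

  nonzero : ℕ → ℤ
  nonzero zero    = 0ℤ
  nonzero (suc _) = 1ℤ

  nonzero-≢0 : ∀ {n} → ¬ n ≡ 0 → nonzero n ≡ 1ℤ
  nonzero-≢0 {zero}  n≢0 = contradiction refl n≢0
  nonzero-≢0 {suc n} _   = refl

  -- For p ≡ 2 (mod 3) every residue is a cube, so [a/p] only records whether p ∣ a.
  cubicSym≡nonzero : ∀ {q} → Prime (suc q) → suc q % 3 ≡ 2 →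
    ∀ a → cubicSym a (suc q) ≡ nonzero (a %ℕ suc q)
  cubicSym≡nonzero {q} p-prime p≡2 a with a %ℕ suc q ℕ.≟ 0
  ... | yes a≡0 = sym (cong nonzero a≡0)
  ... | no a≢0 with cubeSolvable? q a
  ...   | yes _      = sym (nonzero-≢0 a≢0)
  ...   | no noRoot  = contradiction (cubeRoot p-prime p≡2 (a %ℕ suc q) (n%ℕd<d a (suc q))) noRoot

module Determinants where

  open import Data.Nat as ℕ using (ℕ; zero; suc)
  open import Data.Integer using (ℤ; +_; -_; _+_; _*_; 0ℤ; 1ℤ)
  open import Data.Integer.Properties as ℤP using ()
  open import Data.Integer.Tactic.RingSolver using (solve-∀)
  open import Data.Fin using (Fin; zero; suc; toℕ; punchIn; _≟_)
  open import Data.Fin.Properties using (punchInᵢ≢i)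
  open import Algebra.Properties.Semiring.Sum ℤP.+-*-semiring
    using (sum; sum-cong-≗; ∑-comm; *-distribˡ-sum; sum-remove)
  open import Function using (_∘_)
  open import Relation.Nullary using (¬_; yes; no; contradiction)
  open import Relation.Binary.PropositionalEquality
  open ≡-Reasoning

  Matrix : ℕ → Set
  Matrix n = Fin n → Fin n → ℤ

  ∑≡sum : ∀ n (f : Fin n → ℤ) → ∑ n f ≡ sum f
  ∑≡sum zero    f = refl
  ∑≡sum (suc n) f = cong (_+_ (f zero)) (∑≡sum n (λ i → f (suc i)))

  ∑-cong : ∀ n {f g : Fin n → ℤ} → (∀ i → f i ≡ g i) → ∑ n f ≡ ∑ n g
  ∑-cong n {f} {g} f≗g = begin
    ∑ n f    ≡⟨ ∑≡sum n f ⟩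
    sum f    ≡⟨ sum-cong-≗ f≗g ⟩
    sum g    ≡⟨ ∑≡sum n g ⟨
    ∑ n g    ∎

  ∑-*ˡ : ∀ n x (f : Fin n → ℤ) → x * ∑ n f ≡ ∑ n (λ i → x * f i)
  ∑-*ˡ n x f = begin
    x * ∑ n f               ≡⟨ cong (x *_) (∑≡sum n f) ⟩
    x * sum f               ≡⟨ *-distribˡ-sum x f ⟩
    sum (λ i → x * f i)     ≡⟨ ∑≡sum n (λ i → x * f i) ⟨
    ∑ n (λ i → x * f i)     ∎

  ∑-remove : ∀ n (j : Fin (suc n)) (f : Fin (suc n) → ℤ) →
    ∑ (suc n) f ≡ f j + ∑ n (λ k → f (punchIn j k))
  ∑-remove n j f = begin
    ∑ (suc n) f                          ≡⟨ ∑≡sum (suc n) f ⟩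
    sum f                                ≡⟨ sum-remove {i = j} f ⟩
    f j + sum (λ k → f (punchIn j k))    ≡⟨ cong (_+_ (f j)) (∑≡sum n _) ⟨
    f j + ∑ n (λ k → f (punchIn j k))    ∎

  ∑-swap : ∀ m n (f : Fin m → Fin n → ℤ) →
    ∑ m (λ i → ∑ n (f i)) ≡ ∑ n (λ j → ∑ m (λ i → f i j))
  ∑-swap m n f = begin
    ∑ m (λ i → ∑ n (f i))                ≡⟨ ∑-cong m (λ i → ∑≡sum n (f i)) ⟩
    ∑ m (λ i → sum (f i))                ≡⟨ ∑≡sum m _ ⟩
    sum (λ i → sum (f i))                ≡⟨ ∑-comm f ⟩
    sum (λ j → sum (λ i → f i j))        ≡⟨ ∑≡sum n _ ⟨
    ∑ n (λ j → sum (λ i → f i j))        ≡⟨ ∑-cong n (λ j → ∑≡sum m (λ i → f i j)) ⟨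
    ∑ n (λ j → ∑ m (λ i → f i j))        ∎

  ∑-neg : ∀ n (f : Fin n → ℤ) → ∑ n (λ i → - f i) ≡ - ∑ n f
  ∑-neg zero    f = refl
  ∑-neg (suc n) f = trans (cong (_+_ (- f zero)) (∑-neg n (λ i → f (suc i))))
                          (sym (ℤP.neg-distrib-+ (f zero) _))

  ∑-const : ∀ n c → ∑ n (λ _ → c) ≡ + n * c
  ∑-const zero    c = sym (ℤP.*-zeroˡ c)
  ∑-const (suc n) c = trans (cong (_+_ c) (∑-const n c)) (sym (ℤP.suc-* (+ n) c))

  sign : ∀ {n} → Fin n → ℤ
  sign j = sgn (toℕ j)

  sign² : ∀ {n} (j : Fin n) → sign j * sign j ≡ 1ℤ
  sign² j = sgn² (toℕ j)
    where
    neg² : ∀ x → (- x) * (- x) ≡ x * x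
    neg² = solve-∀
    sgn² : ∀ k → sgn k * sgn k ≡ 1ℤ
    sgn² zero    = refl
    sgn² (suc k) = trans (neg² (sgn k)) (sgn² k)

  det-cong : ∀ n {A B : Matrix n} → (∀ i j → A i j ≡ B i j) → det n A ≡ det n B
  det-cong zero    _   = refl
  det-cong (suc n) A≗B = ∑-cong (suc n) λ j →
    cong₂ (λ x y → sign j * x * y) (A≗B zero j) (det-cong n λ i k → A≗B (suc i) (punchIn j k))

  -- A total punchOut: the position of column l once column j is deleted
  -- (the value for l = j is irrelevant).
  punchOut′ : ∀ {m} → Fin (suc (suc m)) → Fin (suc (suc m)) → Fin (suc m)
  punchOut′ zero    zero    = zero
  punchOut′ zero    (suc l) = l
  punchOut′ (suc j) zero    = zero
  punchOut′ {zero}  (suc j) (suc l) = zero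
  punchOut′ {suc m} (suc j) (suc l) = suc (punchOut′ j l)

  punchOut′-punchIn : ∀ {m} (j : Fin (suc (suc m))) (k : Fin (suc m)) → punchOut′ j (punchIn j k) ≡ k
  punchOut′-punchIn zero    k       = refl
  punchOut′-punchIn (suc j) zero    = refl
  punchOut′-punchIn {suc m} (suc j) (suc k) = cong suc (punchOut′-punchIn j k)

  -- Deleting the distinct columns j and l in either order leaves the same columns.
  punchIn-comm : ∀ {m} (j l : Fin (suc (suc m))) → ¬ j ≡ l → ∀ (x : Fin m) →
    punchIn j (punchIn (punchOut′ j l) x) ≡ punchIn l (punchIn (punchOut′ l j) x)
  punchIn-comm zero    zero    j≢l x = contradiction refl j≢l
  punchIn-comm zero    (suc l) j≢l x = refl
  punchIn-comm (suc j) zero    j≢l x = refl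
  punchIn-comm {suc m} (suc j) (suc l) j≢l zero    = refl
  punchIn-comm {suc m} (suc j) (suc l) j≢l (suc x) = cong suc (punchIn-comm j l (λ j≡l → j≢l (cong suc j≡l)) x)

  pairSign-anti : ∀ {m} (j l : Fin (suc (suc m))) → ¬ j ≡ l →
    sign j * sign (punchOut′ j l) ≡ - (sign l * sign (punchOut′ l j))
  pairSign-anti zero zero j≢l = contradiction refl j≢l
  pairSign-anti zero (suc l) _ = law (sign l)
    where law : ∀ x → 1ℤ * x ≡ - ((- x) * 1ℤ)
          law = solve-∀
  pairSign-anti (suc j) zero _ = law (sign j)
    where law : ∀ x → (- x) * 1ℤ ≡ - (1ℤ * x)
          law = solve-∀
  pairSign-anti {zero} (suc zero) (suc zero) j≢l = contradiction refl j≢l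
  pairSign-anti {suc m} (suc j) (suc l) j≢l =
    trans (law (sign j) (sign (punchOut′ j l)))
          (trans (pairSign-anti j l (λ j≡l → j≢l (cong suc j≡l)))
                 (cong -_ (sym (law (sign l) (sign (punchOut′ l j))))))
    where law : ∀ x y → (- x) * (- y) ≡ x * y
          law = solve-∀

  -- Sum of H j l over ordered pairs of distinct indices (l = punchIn j k).
  ∑≠ : ∀ n → (Fin (suc n) → Fin (suc n) → ℤ) → ℤ
  ∑≠ n H = ∑ (suc n) (λ j → ∑ n (λ k → H j (punchIn j k)))

  offDiagonal : ∀ {n} → (Fin n → Fin n → ℤ) → Fin n → Fin n → ℤ
  offDiagonal H j l with j ≟ l
  ... | yes _ = 0ℤ
  ... | no  _ = H j l

  offDiagonal-diag : ∀ {n} (H : Fin n → Fin n → ℤ) j → offDiagonal H j j ≡ 0ℤ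
  offDiagonal-diag H j with j ≟ j
  ... | yes _   = refl
  ... | no j≢j  = contradiction refl j≢j

  offDiagonal-off : ∀ {n} (H : Fin n → Fin n → ℤ) j l → ¬ j ≡ l → offDiagonal H j l ≡ H j l
  offDiagonal-off H j l j≢l with j ≟ l
  ... | yes j≡l = contradiction j≡l j≢l
  ... | no  _   = refl

  ∑-punchIn≡∑-offDiagonal : ∀ n (H : Fin (suc n) → Fin (suc n) → ℤ) j →
    ∑ n (λ k → H j (punchIn j k)) ≡ ∑ (suc n) (offDiagonal H j)
  ∑-punchIn≡∑-offDiagonal n H j = begin
    ∑ n (λ k → H j (punchIn j k))
      ≡⟨ ∑-cong n (λ k → sym (offDiagonal-off H j (punchIn j k) (punchInᵢ≢i j k ∘ sym))) ⟩
    ∑ n (λ k → offDiagonal H j (punchIn j k))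
      ≡⟨ ℤP.+-identityˡ _ ⟨
    0ℤ + ∑ n (λ k → offDiagonal H j (punchIn j k))
      ≡⟨ cong (λ x → x + ∑ n (λ k → offDiagonal H j (punchIn j k))) (offDiagonal-diag H j) ⟨
    offDiagonal H j j + ∑ n (λ k → offDiagonal H j (punchIn j k))
      ≡⟨ ∑-remove n j (offDiagonal H j) ⟨
    ∑ (suc n) (offDiagonal H j) ∎

  ∑≠-anti : ∀ n (H G : Fin (suc n) → Fin (suc n) → ℤ) →
    (∀ j l → ¬ j ≡ l → H j l ≡ - G l j) → ∑≠ n H ≡ - ∑≠ n G
  ∑≠-anti n H G anti = begin
    ∑≠ n H
      ≡⟨ ∑-cong (suc n) (∑-punchIn≡∑-offDiagonal n H) ⟩
    ∑ (suc n) (λ j → ∑ (suc n) (offDiagonal H j))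
      ≡⟨ ∑-cong (suc n) (λ j → ∑-cong (suc n) (offDiagonal-anti j)) ⟩
    ∑ (suc n) (λ j → ∑ (suc n) (λ l → - offDiagonal G l j))
      ≡⟨ ∑-cong (suc n) (λ j → ∑-neg (suc n) (λ l → offDiagonal G l j)) ⟩
    ∑ (suc n) (λ j → - ∑ (suc n) (λ l → offDiagonal G l j))
      ≡⟨ ∑-neg (suc n) (λ j → ∑ (suc n) (λ l → offDiagonal G l j)) ⟩
    - ∑ (suc n) (λ j → ∑ (suc n) (λ l → offDiagonal G l j))
      ≡⟨ cong -_ (∑-swap (suc n) (suc n) (offDiagonal G)) ⟨
    - ∑ (suc n) (λ l → ∑ (suc n) (offDiagonal G l))
      ≡⟨ cong -_ (∑-cong (suc n) (∑-punchIn≡∑-offDiagonal n G)) ⟨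
    - ∑≠ n G ∎
    where
    offDiagonal-anti : ∀ j l → offDiagonal H j l ≡ - offDiagonal G l j
    offDiagonal-anti j l with j ≟ l | l ≟ j
    ... | yes _    | yes _    = refl
    ... | yes refl | no l≢j   = contradiction refl l≢j
    ... | no j≢l   | yes refl = contradiction refl j≢l
    ... | no j≢l   | no _     = anti j l j≢l

  module _ {m : ℕ} where

    minor₂ : (Fin m → Fin (suc (suc m)) → ℤ) → Fin (suc (suc m)) → Fin (suc (suc m)) → Matrix m
    minor₂ R j l i x = R i (punchIn j (punchIn (punchOut′ j l) x))

    pairTerm : (a b : Fin (suc (suc m)) → ℤ) (R : Fin m → Fin (suc (suc m)) → ℤ) →
      Fin (suc (suc m)) → Fin (suc (suc m)) → ℤ
    pairTerm a b R j l = sign j * sign (punchOut′ j l) * (a j * b l * det m (minor₂ R j l))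

    det-twoRows : (A : Matrix (suc (suc m))) →
      det (suc (suc m)) A ≡ ∑≠ (suc m) (pairTerm (A zero) (A (suc zero)) (λ i → A (suc (suc i))))
    det-twoRows A = ∑-cong (suc (suc m)) λ j → begin
      sign j * a j * ∑ (suc m) (λ k → sign k * b (punchIn j k) * D j k)
        ≡⟨ ∑-*ˡ (suc m) (sign j * a j) (λ k → sign k * b (punchIn j k) * D j k) ⟩
      ∑ (suc m) (λ k → sign j * a j * (sign k * b (punchIn j k) * D j k))
        ≡⟨ ∑-cong (suc m) (λ k → trans (regroup (sign j) (a j) (sign k) (b (punchIn j k)) (D j k))
                                        (cong (term j k) (sym (punchOut′-punchIn j k)))) ⟩
      ∑ (suc m) (λ k → pairTerm a b R j (punchIn j k)) ∎
      where
      a = A zero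
      b = A (suc zero)
      R = λ i → A (suc (suc i))
      D : Fin (suc (suc m)) → Fin (suc m) → ℤ
      D j k = det m (λ i x → R i (punchIn j (punchIn k x)))
      term : ∀ j k → Fin (suc m) → ℤ
      term j k k′ = sign j * sign k′ * (a j * b (punchIn j k) * D j k′)
      regroup : ∀ s a t b d → s * a * (t * b * d) ≡ s * t * (a * b * d)
      regroup = solve-∀

    pairTerm-swap : ∀ a b R j l → ¬ j ≡ l → pairTerm b a R j l ≡ - pairTerm a b R l j
    pairTerm-swap a b R j l j≢l = begin
      sign j * sign (punchOut′ j l) * (b j * a l * det m (minor₂ R j l))
        ≡⟨ cong₂ (λ s d → s * (b j * a l * d)) (pairSign-anti j l j≢l)
                 (det-cong m (λ i x → cong (R i) (punchIn-comm j l j≢l x))) ⟩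
      - (sign l * sign (punchOut′ l j)) * (b j * a l * det m (minor₂ R l j))
        ≡⟨ law (sign l * sign (punchOut′ l j)) (b j) (a l) (det m (minor₂ R l j)) ⟩
      - (sign l * sign (punchOut′ l j) * (a l * b j * det m (minor₂ R l j))) ∎
      where law : ∀ s x y d → (- s) * (x * y * d) ≡ - (s * (y * x * d))
            law = solve-∀

  swap01 : ∀ {m} → Matrix (suc (suc m)) → Matrix (suc (suc m))
  swap01 A zero          = A (suc zero)
  swap01 A (suc zero)    = A zero
  swap01 A (suc (suc i)) = A (suc (suc i))

  det-swap01 : ∀ m (A : Matrix (suc (suc m))) → det (suc (suc m)) (swap01 A) ≡ - det (suc (suc m)) A
  det-swap01 m A = begin
    det (suc (suc m)) (swap01 A)       ≡⟨ det-twoRows (swap01 A) ⟩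
    ∑≠ (suc m) (pairTerm b a R)        ≡⟨ ∑≠-anti (suc m) _ _ (pairTerm-swap a b R) ⟩
    - ∑≠ (suc m) (pairTerm a b R)      ≡⟨ cong -_ (det-twoRows A) ⟨
    - det (suc (suc m)) A              ∎
    where
    a = A zero
    b = A (suc zero)
    R = λ i → A (suc (suc i))

  moveToTop : ∀ {n} {X : Set} → Fin n → (Fin n → X) → Fin n → X
  moveToTop k A zero    = A k
  moveToTop k A (suc i) = A (punchIn k i)

  -- For k + 1, let B keep the top
  -- row and move row k + 1 to position 1: expanding along the top row and induction
  -- on the minors give det B = (-1)^k det A, and swapping the top two rows of B
  -- produces the target matrix.
  det-moveToTop : ∀ n (k : Fin n) (A : Matrix n) → det n (moveToTop k A) ≡ sign k * det n A
  det-moveToTop (suc n) zero A = begin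
    det (suc n) (moveToTop zero A)  ≡⟨ det-cong (suc n) same ⟩
    det (suc n) A                   ≡⟨ ℤP.*-identityˡ _ ⟨
    1ℤ * det (suc n) A              ∎
    where same : ∀ i j → moveToTop zero A i j ≡ A i j
          same zero    j = refl
          same (suc i) j = refl
  det-moveToTop (suc (suc m)) (suc k) A = begin
    det (suc (suc m)) (moveToTop (suc k) A) ≡⟨ det-cong (suc (suc m)) swapped ⟩
    det (suc (suc m)) (swap01 B)           ≡⟨ det-swap01 m B ⟩
    - det (suc (suc m)) B                  ≡⟨ cong -_ det-B ⟩
    - (sign k * det (suc (suc m)) A)       ≡⟨ ℤP.neg-distribˡ-* (sign k) _ ⟩
    sign (suc k) * det (suc (suc m)) A     ∎
    where
    B : Matrix (suc (suc m))
    B zero    = A zero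
    B (suc i) = moveToTop k (λ r → A (suc r)) i
    swapped : ∀ i j → moveToTop (suc k) A i j ≡ swap01 B i j
    swapped zero          j = refl
    swapped (suc zero)    j = refl
    swapped (suc (suc i)) j = refl
    minorA : Fin (suc (suc m)) → Matrix (suc m)
    minorA j r x = A (suc r) (punchIn j x)
    minorB : ∀ j r x → B (suc r) (punchIn j x) ≡ moveToTop k (minorA j) r x
    minorB j zero    x = refl
    minorB j (suc r) x = refl
    regroup : ∀ s a t d → s * a * (t * d) ≡ t * (s * a * d)
    regroup = solve-∀
    det-B : det (suc (suc m)) B ≡ sign k * det (suc (suc m)) A
    det-B = begin
      ∑ (suc (suc m)) (λ j → sign j * A zero j * det (suc m) (λ r x → B (suc r) (punchIn j x)))
        ≡⟨ ∑-cong (suc (suc m)) (λ j → cong (λ d → sign j * A zero j * d)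
             (trans (det-cong (suc m) (minorB j)) (det-moveToTop (suc m) k (minorA j)))) ⟩
      ∑ (suc (suc m)) (λ j → sign j * A zero j * (sign k * det (suc m) (minorA j)))
        ≡⟨ ∑-cong (suc (suc m)) (λ j → regroup (sign j) (A zero j) (sign k) (det (suc m) (minorA j))) ⟩
      ∑ (suc (suc m)) (λ j → sign k * (sign j * A zero j * det (suc m) (minorA j)))
        ≡⟨ ∑-*ˡ (suc (suc m)) (sign k) (λ j → sign j * A zero j * det (suc m) (minorA j)) ⟨
      sign k * det (suc (suc m)) A ∎

module DeterminantOfJMinusI where

  open Determinants
  open import Data.Nat as ℕ using (ℕ; zero; suc)
  open import Data.Integer using (+_; -_; _+_; _-_; _*_; 0ℤ; 1ℤ)
  open import Data.Integer.Properties as ℤP using ()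
  open import Data.Integer.Tactic.RingSolver using (solve-∀)
  open import Data.Fin using (Fin; zero; suc; punchIn; _≟_)
  open import Data.Fin.Properties using (punchInᵢ≢i; punchIn-injective)
  open import Data.Product using (_×_; _,_)
  open import Function using (_∘_)
  open import Relation.Nullary using (yes; no)
  open import Relation.Binary.PropositionalEquality
  open ≡-Reasoning

  J-I : ∀ {n} → Matrix n
  J-I = offDiagonal (λ _ _ → 1ℤ)

  J-I′ : ∀ {n} → Matrix n
  J-I′ zero    j = 1ℤ
  J-I′ (suc i) j = J-I (suc i) j

  J-I-punchIn : ∀ {n} (c : Fin (suc n)) (a b : Fin n) → J-I (punchIn c a) (punchIn c b) ≡ J-I a b
  J-I-punchIn c a b with a ≟ b
  ... | yes refl = offDiagonal-diag _ (punchIn c a)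
  ... | no  a≢b  = offDiagonal-off _ _ _ (λ eq → a≢b (punchIn-injective c a b eq))

  module _ {n : ℕ} (M : Matrix (suc n)) (below : ∀ r x → M (suc r) x ≡ J-I (suc r) x) where

    -- Deleting the top row and column 0 of M leaves J − I; deleting the top row and
    -- column j + 1 leaves a matrix that becomes J − I′ once its row j is moved to the top.
    minor-zero : det n (λ r x → M (suc r) (punchIn zero x)) ≡ det n J-I
    minor-zero = det-cong n (λ r x → trans (below r (suc x)) (J-I-punchIn zero r x))

    minor-suc : ∀ j → det n (λ r x → M (suc r) (punchIn (suc j) x)) ≡ sign j * det n J-I′
    minor-suc j = begin
      det n minor                        ≡⟨ ℤP.*-identityˡ _ ⟨
      1ℤ * det n minor                   ≡⟨ cong (_* det n minor) (sign² j) ⟨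
      sign j * sign j * det n minor      ≡⟨ ℤP.*-assoc (sign j) (sign j) _ ⟩
      sign j * (sign j * det n minor)    ≡⟨ cong (sign j *_) (det-moveToTop n j minor) ⟨
      sign j * det n (moveToTop j minor) ≡⟨ cong (sign j *_) (det-cong n moved) ⟩
      sign j * det n J-I′                ∎
      where
      minor : Matrix n
      minor r x = M (suc r) (punchIn (suc j) x)
      moved : ∀ r x → moveToTop j minor r x ≡ J-I′ r x
      moved zero    x = trans (below j (punchIn (suc j) x))
                              (offDiagonal-off _ _ _ (punchInᵢ≢i (suc j) x ∘ sym))
      moved (suc r) x = trans (below (punchIn j r) (punchIn (suc j) x)) (J-I-punchIn (suc j) (suc r) x)

    det-topRow : (∀ j → M zero (suc j) ≡ 1ℤ) →
      det (suc n) M ≡ M zero zero * det n J-I - + n * det n J-I′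
    det-topRow ones = begin
      1ℤ * M zero zero * det n (λ r x → M (suc r) (punchIn zero x))
        + ∑ n (λ j → sign (suc j) * M zero (suc j) * det n (λ r x → M (suc r) (punchIn (suc j) x)))
        ≡⟨ cong₂ _+_ (cong (1ℤ * M zero zero *_) minor-zero)
                     (∑-cong n (λ j → cong₂ (λ a d → sign (suc j) * a * d) (ones j) (minor-suc j))) ⟩
      1ℤ * M zero zero * X + ∑ n (λ j → - sign j * 1ℤ * (sign j * Y))
        ≡⟨ cong (_+_ (1ℤ * M zero zero * X)) (∑-cong n (λ j →
             trans (law (sign j) Y) (cong (λ s → - (s * Y)) (sign² j)))) ⟩
      1ℤ * M zero zero * X + ∑ n (λ _ → - (1ℤ * Y))
        ≡⟨ cong (_+_ (1ℤ * M zero zero * X)) (∑-const n (- (1ℤ * Y))) ⟩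
      1ℤ * M zero zero * X + + n * - (1ℤ * Y)
        ≡⟨ tidy (M zero zero) X (+ n) Y ⟩
      M zero zero * X - + n * Y ∎
      where
      X = det n J-I
      Y = det n J-I′
      law : ∀ s y → - s * 1ℤ * (s * y) ≡ - (s * s * y)
      law = solve-∀
      tidy : ∀ m x k y → 1ℤ * m * x + k * - (1ℤ * y) ≡ m * x - k * y
      tidy = solve-∀

  det-J-I : ∀ n → det (suc n) J-I′ ≡ sgn n × det (suc n) J-I ≡ sgn n * + n
  det-J-I zero = refl , refl
  det-J-I (suc n) with det-J-I n
  ... | Y≡ , X≡ = Y′≡ , X′≡
    where
    Y′≡ : det (suc (suc n)) J-I′ ≡ - sgn n
    Y′≡ = begin
      det (suc (suc n)) J-I′                          ≡⟨ det-topRow {suc n} J-I′ (λ _ _ → refl) (λ _ → refl) ⟩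
      1ℤ * det (suc n) J-I - + suc n * det (suc n) J-I′ ≡⟨ cong₂ (λ x y → 1ℤ * x - + suc n * y) X≡ Y≡ ⟩
      1ℤ * (sgn n * + n) - + suc n * sgn n            ≡⟨ law (sgn n) (+ n) ⟩
      - sgn n                                          ∎
      where law : ∀ s k → 1ℤ * (s * k) - (1ℤ + k) * s ≡ - s
            law = solve-∀
    X′≡ : det (suc (suc n)) J-I ≡ - sgn n * + suc n
    X′≡ = begin
      det (suc (suc n)) J-I                           ≡⟨ det-topRow {suc n} J-I (λ _ _ → refl) (λ _ → refl) ⟩
      0ℤ * det (suc n) J-I - + suc n * det (suc n) J-I′ ≡⟨ cong (λ y → 0ℤ * det (suc n) J-I - + suc n * y) Y≡ ⟩
      0ℤ * det (suc n) J-I - + suc n * sgn n          ≡⟨ law (det (suc n) J-I) (sgn n) (+ n) ⟩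
      - sgn n * + suc n                               ∎
      where law : ∀ x s k → 0ℤ * x - (1ℤ + k) * s ≡ - s * (1ℤ + k)
            law = solve-∀

module CirculantMatrices where

  open Determinants
  open DeterminantOfJMinusI using (J-I)
  open CubicResidueSymbol using (nonzero; nonzero-≢0; cubicSym≡nonzero)
  open import Data.Nat as ℕ using (ℕ; zero; suc; NonZero; _%_)
  import Data.Nat.Properties as ℕP
  open import Data.Integer using (+_; -[1+_]; -_; _+_; _-_; _*_; 0ℤ; 1ℤ)
  open import Data.Integer.DivMod using (_%ℕ_; _/ℕ_; a≡a%ℕn+[a/ℕn]*n; n%ℕd<d)
  open import Data.Integer.Properties as ℤP using ()
  open import Data.Integer.Tactic.RingSolver using (solve-∀)
  open import Data.Fin using (Fin; zero; suc; toℕ; fromℕ; punchIn; _≟_)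
  open import Data.Fin.Properties using (toℕ-injective; toℕ<n; toℕ-fromℕ)
  open import Relation.Nullary using (¬_; yes; no; contradiction)
  open import Relation.Binary.PropositionalEquality
  open ≡-Reasoning

  ≢+positiveMultiple : ∀ {d r r′} m → r ℕ.< d → ¬ (+ r ≡ + r′ + + suc m * + d)
  ≢+positiveMultiple {d} {r} {r′} m r<d eq = ℕP.<⇒≱ r<d (subst (d ℕ.≤_) (sym r≡) d≤)
    where
    r≡ : r ≡ r′ ℕ.+ suc m ℕ.* d
    r≡ = ℤP.+-injective (trans eq (trans (cong (_+_ (+ r′)) (sym (ℤP.pos-* (suc m) d)))
                                          (sym (ℤP.pos-+ r′ _))))
    d≤ : d ℕ.≤ r′ ℕ.+ suc m ℕ.* d
    d≤ = ℕP.≤-trans (ℕP.m≤m+n d (m ℕ.* d)) (ℕP.m≤n+m _ r′)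

  residue-unique : ∀ d r r′ k → r ℕ.< d → r′ ℕ.< d → + r ≡ + r′ + k * + d → r ≡ r′
  residue-unique d r r′ (+ zero) _ _ eq =
    ℤP.+-injective (trans eq (trans (cong (_+_ (+ r′)) (ℤP.*-zeroˡ (+ d))) (ℤP.+-identityʳ _)))
  residue-unique d r r′ (+ suc m) r<d _ eq = contradiction eq (≢+positiveMultiple m r<d)
  residue-unique d r r′ -[1+ m ] _ r′<d eq = contradiction eq′ (≢+positiveMultiple m r′<d)
    where
    law : ∀ a k d → a ≡ (a + k * d) + (- k) * d
    law = solve-∀
    eq′ : + r′ ≡ + r + + suc m * + d
    eq′ = trans (law (+ r′) -[1+ m ] (+ d)) (cong (λ x → x + + suc m * + d) (sym eq))

  %ℕ-periodic : ∀ a d .{{_ : NonZero d}} → (a + + d) %ℕ d ≡ a %ℕ d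
  %ℕ-periodic a d = residue-unique d _ _ (Q₀ + 1ℤ - Q₁) (n%ℕd<d (a + + d) d) (n%ℕd<d a d) (begin
    + r₁                          ≡⟨ law₁ (+ r₁) Q₁ (+ d) ⟩
    (+ r₁ + Q₁ * + d) - Q₁ * + d  ≡⟨ cong (_- Q₁ * + d) (a≡a%ℕn+[a/ℕn]*n (a + + d) d) ⟨
    (a + + d) - Q₁ * + d          ≡⟨ cong (λ x → x + + d - Q₁ * + d) (a≡a%ℕn+[a/ℕn]*n a d) ⟩
    + r₀ + Q₀ * + d + + d - Q₁ * + d ≡⟨ law₂ (+ r₀) Q₀ Q₁ (+ d) ⟩
    + r₀ + (Q₀ + 1ℤ - Q₁) * + d   ∎)
    where
    r₁ = (a + + d) %ℕ d
    r₀ = a %ℕ d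
    Q₁ = (a + + d) /ℕ d
    Q₀ = a /ℕ d
    law₁ : ∀ r Q d → r ≡ (r + Q * d) - Q * d
    law₁ = solve-∀
    law₂ : ∀ r Q Q′ d → r + Q * d + d - Q′ * d ≡ r + (Q + 1ℤ - Q′) * d
    law₂ = solve-∀

  %ℕ-difference : ∀ {d} .{{_ : NonZero d}} (i j : Fin d) → (+ toℕ j - + toℕ i) %ℕ d ≡ 0 → i ≡ j
  %ℕ-difference {d} i j j-i≡0 = toℕ-injective (sym (residue-unique d _ _ Q (toℕ<n j) (toℕ<n i) (begin
    + toℕ j                              ≡⟨ law (+ toℕ j) (+ toℕ i) ⟩
    + toℕ i + (+ toℕ j - + toℕ i)        ≡⟨ cong (_+_ (+ toℕ i)) (a≡a%ℕn+[a/ℕn]*n (+ toℕ j - + toℕ i) d) ⟩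
    + toℕ i + (+ ((+ toℕ j - + toℕ i) %ℕ d) + Q * + d)
      ≡⟨ cong (λ r → + toℕ i + (+ r + Q * + d)) j-i≡0 ⟩
    + toℕ i + (0ℤ + Q * + d)             ≡⟨ cong (_+_ (+ toℕ i)) (ℤP.+-identityˡ (Q * + d)) ⟩
    + toℕ i + Q * + d                    ∎)))
    where
    Q = (+ toℕ j - + toℕ i) /ℕ d
    law : ∀ x y → x ≡ y + (x - y)
    law = solve-∀

  circulant : ∀ q → ℕ → Matrix (suc q)
  circulant q t i j = nonzero ((+ toℕ j - + toℕ i + + t) %ℕ suc q)

  Mp≡circulant : ∀ {q} → Prime (suc q) → suc q % 3 ≡ 2 → ∀ c i j → Mp (suc q) c i j ≡ circulant q c i j
  Mp≡circulant p-prime p≡2 c i j = cubicSym≡nonzero p-prime p≡2 (+ toℕ j - + toℕ i + + c)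

  circulant-zero : ∀ q i j → circulant q 0 i j ≡ J-I i j
  circulant-zero q i j with i ≟ j
  ... | yes refl = cong (λ x → nonzero (x %ℕ suc q)) (law (+ toℕ i))
    where law : ∀ x → x - x + 0ℤ ≡ 0ℤ
          law = solve-∀
  ... | no i≢j = nonzero-≢0 (λ ≡0 → i≢j (%ℕ-difference i j
                   (trans (cong (_%ℕ suc q) (sym (ℤP.+-identityʳ (+ toℕ j - + toℕ i)))) ≡0)))

  toℕ-punchIn-last : ∀ {q} (i : Fin q) → toℕ (punchIn (fromℕ q) i) ≡ toℕ i
  toℕ-punchIn-last {suc q} zero    = refl
  toℕ-punchIn-last {suc q} (suc i) = cong suc (toℕ-punchIn-last i)

  circulant-rotate : ∀ q t i j → moveToTop (fromℕ q) (circulant q t) i j ≡ circulant q (suc t) i j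
  circulant-rotate q t zero j = begin
    nonzero ((+ toℕ j - + toℕ (fromℕ q) + + t) %ℕ suc q)
      ≡⟨ cong (λ x → nonzero ((+ toℕ j - + x + + t) %ℕ suc q)) (toℕ-fromℕ q) ⟩
    nonzero ((+ toℕ j - + q + + t) %ℕ suc q)
      ≡⟨ cong nonzero (%ℕ-periodic (+ toℕ j - + q + + t) (suc q)) ⟨
    nonzero ((+ toℕ j - + q + + t + + suc q) %ℕ suc q)
      ≡⟨ cong (λ x → nonzero (x %ℕ suc q)) (law (+ toℕ j) (+ q) (+ t)) ⟩
    nonzero ((+ toℕ j - 0ℤ + + suc t) %ℕ suc q) ∎
    where law : ∀ x y t → x - y + t + (1ℤ + y) ≡ x - 0ℤ + (1ℤ + t)
          law = solve-∀
  circulant-rotate q t (suc i) j = begin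
    nonzero ((+ toℕ j - + toℕ (punchIn (fromℕ q) i) + + t) %ℕ suc q)
      ≡⟨ cong (λ x → nonzero ((+ toℕ j - + x + + t) %ℕ suc q)) (toℕ-punchIn-last i) ⟩
    nonzero ((+ toℕ j - + toℕ i + + t) %ℕ suc q)
      ≡⟨ cong (λ x → nonzero (x %ℕ suc q)) (law (+ toℕ j) (+ toℕ i) (+ t)) ⟩
    nonzero ((+ toℕ j - + suc (toℕ i) + + suc t) %ℕ suc q) ∎
    where law : ∀ x y t → x - y + t ≡ x - (1ℤ + y) + (1ℤ + t)
          law = solve-∀

  -- When q is even the rotation preserves det, so det is the same for every t as for t = 0.
  det-circulant : ∀ q → sgn q ≡ 1ℤ → ∀ t → det (suc q) (circulant q t) ≡ det (suc q) J-I
  det-circulant q even zero    = det-cong (suc q) (circulant-zero q)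
  det-circulant q even (suc t) = begin
    det (suc q) (circulant q (suc t))                     ≡⟨ det-cong (suc q) (circulant-rotate q t) ⟨
    det (suc q) (moveToTop (fromℕ q) (circulant q t))     ≡⟨ det-moveToTop (suc q) (fromℕ q) (circulant q t) ⟩
    sign (fromℕ q) * det (suc q) (circulant q t)          ≡⟨ cong (λ s → sgn s * det (suc q) (circulant q t)) (toℕ-fromℕ q) ⟩
    sgn q * det (suc q) (circulant q t)                   ≡⟨ cong (_* det (suc q) (circulant q t)) even ⟩
    1ℤ * det (suc q) (circulant q t)                      ≡⟨ ℤP.*-identityˡ _ ⟩
    det (suc q) (circulant q t)                           ≡⟨ det-circulant q even t ⟩
    det (suc q) J-I                                       ∎

open Determinants using (det-cong)
open DeterminantOfJMinusI using (J-I; det-J-I)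
open CirculantMatrices using (circulant; Mp≡circulant; det-circulant)
open import Data.Nat.Properties using (+-comm)
open import Data.Nat.DivMod using ([m+n]%n≡m%n)
open import Data.Integer using (_*_; 1ℤ)
open import Data.Integer.Properties using (*-identityˡ; neg-involutive)
open import Data.Product using (proj₂)
open import Relation.Binary.PropositionalEquality using (refl; sym; trans; cong; module ≡-Reasoning)
open ≡-Reasoning

sgn-even : ∀ k → suc k % 2 ≡ 1 → sgn k ≡ 1ℤ
sgn-even zero          _   = refl
sgn-even (suc zero)    ()
sgn-even (suc (suc k)) odd = trans (neg-involutive (sgn k)) (sgn-even k suc-k-odd)
  where
  suc-k-odd : suc k % 2 ≡ 1
  suc-k-odd = trans (sym ([m+n]%n≡m%n (suc k) 2)) (trans (cong (_% 2) (+-comm (suc k) 2)) odd)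

-- p ≡ 2 (mod 3) rules out p = 0, 1.
theorem3p5 : (p c : ℕ) → Prime p → p % 2 ≡ 1 → p % 3 ≡ 2 →
    1 ≤ c → c ≤ p ∸ 1 →
    det p (Mp p c) ≡ + (p ∸ 1)
theorem3p5 zero          c _       _     ()  _ _
theorem3p5 (suc zero)    c _       _     ()  _ _
theorem3p5 (suc (suc n)) c p-prime p-odd p≡2 _ _ = begin
  det p (Mp p c)              ≡⟨ det-cong p (Mp≡circulant p-prime p≡2 c) ⟩
  det p (circulant (suc n) c) ≡⟨ det-circulant (suc n) p-1-even c ⟩
  det p J-I                   ≡⟨ proj₂ (det-J-I (suc n)) ⟩
  sgn (suc n) * + suc n       ≡⟨ cong (_* + suc n) p-1-even ⟩
  1ℤ * + suc n                ≡⟨ *-identityˡ (+ suc n) ⟩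
  + suc n                     ∎
  where
  p = suc (suc n)
  p-1-even : sgn (suc n) ≡ 1ℤ
  p-1-even = sgn-even (suc n) p-odd
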